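{- For any Rose Window graph $\Gamma=R_n(a,r)$ the following are equivalent: (i) $\Gamma$ is bipartite; (ii) the canonical double cover $\Gamma\times\mathbf{K}_2$ is disconnected; (iii) $n$ and $a$ are even and $r$ is odd (as integer representatives in $\{0,\dots,n-1\}$).
   Context: For $n\ge3$ and nonzero $a,r\in\mathbb{Z}_n$, the Rose Window graph $R_n(a,r)$ has vertex set $\{u_i,v_i: i\in\mathbb{Z}_n\}$ and edges $\{u_i,u_{i+1}\},\{v_i,v_{i+r}\},\{u_i,v_i\},\{u_{i+a},v_i\}$ (indices mod $n$). The canonical double cover $\Gamma\times\mathbf{K}_2$ has vertex set $V(\Gamma)\times\{0,1\}$ and edges $\{(u,0),(v,1)\}$ for $\{u,v\}\in E(\Gamma)$. -}

module Defs where

open import Data.Nat using (ℕ; NonZero; _+_)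
open import Data.Nat.DivMod using (_mod_)
open import Data.Fin using (Fin; toℕ)
open import Data.Bool using (Bool; true; false; _≟_)
open import Data.Product using (Σ; _×_; _,_)
open import Data.Sum using (_⊎_)
open import Relation.Nullary using (¬_)
open import Relation.Binary.PropositionalEquality using (_≡_; _≢_)
open import Relation.Binary.Construct.Closure.ReflexiveTransitive using (Star)

record Graph : Set₁ where
  field
    Vertex : Set
    Adj    : Vertex → Vertex → Set
open Graph public

Bipartite : Graph → Set
Bipartite G = Σ (Vertex G → Bool) λ c → ∀ x y → Adj G x y → c x ≢ c y

Connected : Graph → Set
Connected G = ∀ x y → Star (Adj G) x y

Disconnected : Graph → Set
Disconnected G = ¬ Connected G

DoubleCover : Graph → Graph
DoubleCover G = record
  { Vertex = Vertex G × Bool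
  ; Adj    = λ { (x , b) (y , b') → Adj G x y × b ≢ b' }
  }

data RWVertex (n : ℕ) : Set where
  u : Fin n → RWVertex n
  v : Fin n → RWVertex n

_⊕_ : {n : ℕ} .{{_ : NonZero n}} → Fin n → Fin n → Fin n
_⊕_ {n} i j = (toℕ i + toℕ j) mod n

data RWEdge (n : ℕ) .{{_ : NonZero n}} (a r : Fin n) : RWVertex n → RWVertex n → Set where
  rim   : ∀ i → RWEdge n a r (u i) (u (i ⊕ (1 mod n)))
  hub   : ∀ i → RWEdge n a r (v i) (v (i ⊕ r))
  spoke : ∀ i → RWEdge n a r (u i) (v i)
  spoke' : ∀ i → RWEdge n a r (u (i ⊕ a)) (v i)

RoseWindow : (n : ℕ) .{{_ : NonZero n}} → Fin n → Fin n → Graph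
RoseWindow n a r = record
  { Vertex = RWVertex n
  ; Adj    = λ x y → RWEdge n a r x y ⊎ RWEdge n a r y x
  }

{-# OPTIONS --safe #-}
-- A proper 2-colouring c of Γ makes b xor c(x) constant along the walks of Γ × K₂, so the two
-- lifts of a vertex are never joined. Conversely, in R_n(a,r) the rim and the spokes reach every
-- vertex from the two lifts of u₀, so Γ × K₂ is connected as soon as some closed walk through u₀
-- has odd length: the rim if n is odd, the rim walk to u_a closed by the spokes at v₀ if a is
-- odd, and u₀ v₀ v_r u_r followed by the rim back if r is even. If n and a are even and r is
-- odd, colouring u_i by the parity of i and v_i by the opposite parity is proper.
module Submission where

open import Defs
open import Data.Bool using (Bool; true; false; not; _xor_)
open import Data.Bool.Properties using (not-involutive; not-¬; ¬-not; not-distribˡ-xor; not-distribʳ-xor)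
open import Data.Fin using (Fin; toℕ)
open import Data.Fin.Properties using (toℕ-fromℕ<; toℕ-injective; toℕ<n; fromℕ<-cong)
open import Data.Nat using (ℕ; NonZero; zero; suc; _+_; _*_; _%_; _/_; _≤_; parity)
open import Data.Nat.DivMod using (_mod_; %-distribˡ-+; m≡m%n+[m/n]*n; m<n⇒m%n≡m; [m+n]%n≡m%n)
open import Data.Nat.Divisibility using (_∣_; _∣?_; divides; ∣-refl; ∣m∣n⇒∣m+n; ∣n⇒∣m*n)
open import Data.Nat.Properties using (+-comm)
open import Data.Parity.Base using (Parity; 0ℙ; 1ℙ; _⁻¹) renaming (_+_ to _+ℙ_)
open import Data.Parity.Properties using (+-homo-+; *-homo-*; suc-homo-⁻¹; ⁻¹-selfInverse)
  renaming (+-comm to +ℙ-comm; +-identityʳ to +ℙ-identityʳ; *-zeroʳ to *ℙ-zeroʳ)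
open import Data.Product using (_×_; _,_)
open import Data.Sum using (inj₁; inj₂; [_,_]; swap)
open import Function.Base using (_∘_)
open import Function.Bundles using (_⇔_; mk⇔)
open import Relation.Binary.Definitions using (Symmetric)
open import Relation.Binary.Construct.Closure.ReflexiveTransitive using (Star; ε; _◅_; _◅◅_; fold; reverse)
open import Relation.Binary.PropositionalEquality
  using (_≡_; _≢_; refl; sym; trans; cong; cong₂; subst; ≢-sym; module ≡-Reasoning)
open import Relation.Nullary using (¬_; yes; no; contradiction)

xor-≢ : ∀ {b b′ p q} → b ≢ b′ → p ≢ q → b xor p ≡ b′ xor q
xor-≢ {b} {b′} {p} {q} b≢b′ p≢q = begin
  b xor p             ≡⟨ sym (not-involutive _) ⟩
  not (not (b xor p)) ≡⟨ cong not (not-distribʳ-xor b p) ⟩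
  not (b xor not p)   ≡⟨ not-distribˡ-xor b (not p) ⟩
  not b xor not p     ≡⟨ cong₂ _xor_ (sym (¬-not (≢-sym b≢b′))) (sym (¬-not (≢-sym p≢q))) ⟩
  b′ xor q            ∎
  where open ≡-Reasoning

module _ (G : Graph) where

  private
    _⇝_ : Vertex (DoubleCover G) → Vertex (DoubleCover G) → Set
    _⇝_ = Star (Adj (DoubleCover G))

  lift : ∀ {x y} b → Adj G x y → Adj (DoubleCover G) (x , b) (y , not b)
  lift b e = e , not-¬ refl

  doubleCover-symmetric : Symmetric (Adj G) → Symmetric (Adj (DoubleCover G))
  doubleCover-symmetric sym-G (e , b≢b′) = sym-G e , ≢-sym b≢b′

  bipartite⇒disconnected-doubleCover : Vertex G → Bipartite G → Disconnected (DoubleCover G)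
  bipartite⇒disconnected-doubleCover x₀ (c , proper) connected =
    not-¬ refl (walk-invariant (connected (x₀ , false) (x₀ , true)))
    where
    sheet : Vertex (DoubleCover G) → Bool
    sheet (x , b) = b xor c x

    edge-invariant : ∀ {p q} → Adj (DoubleCover G) p q → sheet p ≡ sheet q
    edge-invariant {x , _} {y , _} (e , b≢b′) = xor-≢ b≢b′ (proper x y e)

    walk-invariant : ∀ {p q} → p ⇝ q → sheet p ≡ sheet q
    walk-invariant = fold (λ p q → sheet p ≡ sheet q) (λ e → trans (edge-invariant e)) refl

reachable-from⇒connected : (G : Graph) → Symmetric (Adj G) → (x₀ : Vertex G) →
                      (∀ x → Star (Adj G) x₀ x) → Connected G
reachable-from⇒connected G sym-G x₀ reach x y = reverse sym-G (reach x) ◅◅ reach y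

flipBy : Parity → Bool → Bool
flipBy 0ℙ b = b
flipBy 1ℙ b = not b

flipBy-⁻¹ : ∀ p b → flipBy (p ⁻¹) b ≡ not (flipBy p b)
flipBy-⁻¹ 0ℙ b = refl
flipBy-⁻¹ 1ℙ b = sym (not-involutive b)

flipBy-not : ∀ p b → flipBy p (not b) ≡ not (flipBy p b)
flipBy-not 0ℙ b = refl
flipBy-not 1ℙ b = refl

flipBy-involutive : ∀ p b → flipBy p (flipBy p b) ≡ b
flipBy-involutive 0ℙ b = refl
flipBy-involutive 1ℙ b = not-involutive b

parity-suc : ∀ k → parity (suc k) ≡ parity k ⁻¹
parity-suc k = sym (⁻¹-selfInverse (suc-homo-⁻¹ k))

2∣⇒parity≡0ℙ : ∀ {m} → 2 ∣ m → parity m ≡ 0ℙ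
2∣⇒parity≡0ℙ (divides q refl) = trans (*-homo-* q 2) (*ℙ-zeroʳ (parity q))

parity≡0ℙ⇒2∣ : ∀ m → parity m ≡ 0ℙ → 2 ∣ m
parity≡0ℙ⇒2∣ zero          _    = divides 0 refl
parity≡0ℙ⇒2∣ (suc zero)    ()
parity≡0ℙ⇒2∣ (suc (suc m)) even = ∣m∣n⇒∣m+n ∣-refl (parity≡0ℙ⇒2∣ m even)

¬2∣⇒parity≡1ℙ : ∀ m → ¬ 2 ∣ m → parity m ≡ 1ℙ
¬2∣⇒parity≡1ℙ m odd with parity m in eq
... | 0ℙ = contradiction (parity≡0ℙ⇒2∣ m eq) odd
... | 1ℙ = refl

parity-% : ∀ m n .{{_ : NonZero n}} → 2 ∣ n → parity (m % n) ≡ parity m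
parity-% m n 2∣n = begin
  parity (m % n)                         ≡⟨ sym (+ℙ-identityʳ _) ⟩
  parity (m % n) +ℙ 0ℙ                   ≡⟨ cong (parity (m % n) +ℙ_) (sym (2∣⇒parity≡0ℙ 2∣[m/n]*n)) ⟩
  parity (m % n) +ℙ parity (m / n * n)   ≡⟨ sym (+-homo-+ (m % n) (m / n * n)) ⟩
  parity (m % n + m / n * n)             ≡⟨ cong parity (sym (m≡m%n+[m/n]*n m n)) ⟩
  parity m                               ∎
  where
  open ≡-Reasoning
  2∣[m/n]*n : 2 ∣ m / n * n
  2∣[m/n]*n = ∣n⇒∣m*n (m / n) 2∣n

module _ {n : ℕ} .{{_ : NonZero n}} where

  toℕ-mod : ∀ m → toℕ (m mod n) ≡ m % n
  toℕ-mod m = toℕ-fromℕ< _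

  mod-cong : ∀ {m m′} → m % n ≡ m′ % n → m mod n ≡ m′ mod n
  mod-cong eq = fromℕ<-cong _ _ eq _ _

  toℕ-mod-inverse : ∀ (i : Fin n) → toℕ i mod n ≡ i
  toℕ-mod-inverse i = toℕ-injective (trans (toℕ-mod (toℕ i)) (m<n⇒m%n≡m (toℕ<n i)))

  mod-⊕ : ∀ k m → (k mod n) ⊕ (m mod n) ≡ (k + m) mod n
  mod-⊕ k m = mod-cong (begin
    (toℕ (k mod n) + toℕ (m mod n)) % n ≡⟨ cong₂ (λ x y → (x + y) % n) (toℕ-mod k) (toℕ-mod m) ⟩
    (k % n + m % n) % n                 ≡⟨ sym (%-distribˡ-+ k m n) ⟩
    (k + m) % n                         ∎)
    where open ≡-Reasoning

  0-⊕ : ∀ (i : Fin n) → (0 mod n) ⊕ i ≡ toℕ i mod n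
  0-⊕ i = trans (cong ((0 mod n) ⊕_) (sym (toℕ-mod-inverse i))) (mod-⊕ 0 (toℕ i))

  mod-⊕-1 : ∀ k → (k mod n) ⊕ (1 mod n) ≡ suc k mod n
  mod-⊕-1 k = trans (mod-⊕ k 1) (cong (_mod n) (+-comm k 1))

  n-mod : n mod n ≡ 0 mod n
  n-mod = mod-cong ([m+n]%n≡m%n 0 n)

  parity-⊕ : 2 ∣ n → ∀ i j → parity (toℕ (i ⊕ j)) ≡ parity (toℕ i) +ℙ parity (toℕ j)
  parity-⊕ 2∣n i j = begin
    parity (toℕ (i ⊕ j))               ≡⟨ cong parity (toℕ-mod (toℕ i + toℕ j)) ⟩
    parity ((toℕ i + toℕ j) % n)       ≡⟨ parity-% (toℕ i + toℕ j) n 2∣n ⟩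
    parity (toℕ i + toℕ j)             ≡⟨ +-homo-+ (toℕ i) (toℕ j) ⟩
    parity (toℕ i) +ℙ parity (toℕ j)   ∎
    where open ≡-Reasoning

  parity-⊕-odd : 2 ∣ n → ∀ i j → parity (toℕ j) ≡ 1ℙ →
                 parity (toℕ (i ⊕ j)) ≡ parity (toℕ i) ⁻¹
  parity-⊕-odd 2∣n i j odd =
    trans (parity-⊕ 2∣n i j) (trans (cong (parity (toℕ i) +ℙ_) odd) (+ℙ-comm (parity (toℕ i)) 1ℙ))

  parity-⊕-even : 2 ∣ n → ∀ i j → parity (toℕ j) ≡ 0ℙ →
                  parity (toℕ (i ⊕ j)) ≡ parity (toℕ i)
  parity-⊕-even 2∣n i j even =
    trans (parity-⊕ 2∣n i j) (trans (cong (parity (toℕ i) +ℙ_) even) (+ℙ-identityʳ (parity (toℕ i))))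

module RoseWindowDoubleCover (n : ℕ) .{{_ : NonZero n}} (a r : Fin n) where

  Γ : Graph
  Γ = RoseWindow n a r

  _⇝_ : Vertex (DoubleCover Γ) → Vertex (DoubleCover Γ) → Set
  _⇝_ = Star (Adj (DoubleCover Γ))

  Γ-symmetric : Symmetric (Adj Γ)
  Γ-symmetric = swap

  bipartite⇒disconnected : Bipartite Γ → Disconnected (DoubleCover Γ)
  bipartite⇒disconnected = bipartite⇒disconnected-doubleCover Γ (u (0 mod n))

  û : ℕ → Bool → Vertex (DoubleCover Γ)
  û k b = u (k mod n) , b

  u-cong₂ : ∀ {i j : Fin n} {b c} → i ≡ j → b ≡ c →
            _≡_ {A = Vertex (DoubleCover Γ)} (u i , b) (u j , c)
  u-cong₂ = cong₂ (λ i c → u i , c)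

  retarget : ∀ {p q q′} → q ≡ q′ → p ⇝ q → p ⇝ q′
  retarget {p} = subst (p ⇝_)

  rim-walk : ∀ k b → û 0 b ⇝ û k (flipBy (parity k) b)
  rim-walk zero    b = ε
  rim-walk (suc k) b =
    rim-walk k b ◅◅ retarget (u-cong₂ (mod-⊕-1 k) sheet-flips) (lift Γ _ (inj₁ (rim (k mod n))) ◅ ε)
    where
    sheet-flips : not (flipBy (parity k) b) ≡ flipBy (parity (suc k)) b
    sheet-flips = trans (sym (flipBy-⁻¹ (parity k) b)) (cong (λ p → flipBy p b) (sym (parity-suc k)))

  rim-walk-of-parity : ∀ k {p} → parity k ≡ p → ∀ b → û 0 b ⇝ û k (flipBy p b)
  rim-walk-of-parity k eq b = retarget (cong (û k) (cong (λ p → flipBy p b) eq)) (rim-walk k b)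

  Γ₂-symmetric : Symmetric (Adj (DoubleCover Γ))
  Γ₂-symmetric = doubleCover-symmetric Γ Γ-symmetric

  LiftsJoined : Set
  LiftsJoined = ∀ b → û 0 b ⇝ û 0 (not b)

  2∤n⇒liftsJoined : ¬ 2 ∣ n → LiftsJoined
  2∤n⇒liftsJoined 2∤n b =
    retarget (u-cong₂ n-mod refl) (rim-walk-of-parity n (¬2∣⇒parity≡1ℙ n 2∤n) b)

  2∤a⇒liftsJoined : ¬ 2 ∣ toℕ a → LiftsJoined
  2∤a⇒liftsJoined 2∤a b =
    rim-walk-of-parity (toℕ a) (¬2∣⇒parity≡1ℙ (toℕ a) 2∤a) b ◅◅
    retarget (u-cong₂ refl (not-involutive (not b))) spokes
    where
    spoke'-at-0 : RWEdge n a r (u (toℕ a mod n)) (v (0 mod n))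
    spoke'-at-0 = subst (λ i → RWEdge n a r (u i) (v (0 mod n))) (0-⊕ a) (spoke' (0 mod n))

    spokes : û (toℕ a) (not b) ⇝ û 0 (not (not (not b)))
    spokes = lift Γ _ (inj₁ spoke'-at-0) ◅ lift Γ _ (inj₂ (spoke (0 mod n))) ◅ ε

  2∣r⇒liftsJoined : 2 ∣ toℕ r → LiftsJoined
  2∣r⇒liftsJoined 2∣r b =
    retarget (u-cong₂ (0-⊕ r) (not-involutive (not b))) spokes-and-hub ◅◅
    reverse Γ₂-symmetric (rim-walk-of-parity (toℕ r) (2∣⇒parity≡0ℙ 2∣r) (not b))
    where
    spokes-and-hub : û 0 b ⇝ (u ((0 mod n) ⊕ r) , not (not (not b)))
    spokes-and-hub =
      lift Γ _ (inj₁ (spoke (0 mod n))) ◅ lift Γ _ (inj₁ (hub (0 mod n))) ◅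
      lift Γ _ (inj₂ (spoke ((0 mod n) ⊕ r))) ◅ ε

  liftsJoined⇒connected : LiftsJoined → Connected (DoubleCover Γ)
  liftsJoined⇒connected joined =
    reachable-from⇒connected (DoubleCover Γ) Γ₂-symmetric (û 0 false) reach
    where
    reach-fibre : ∀ b → û 0 false ⇝ û 0 b
    reach-fibre false = ε
    reach-fibre true  = joined false

    reach : ∀ x → û 0 false ⇝ x
    reach (u i , b) =
      reach-fibre _ ◅◅
      retarget (u-cong₂ (toℕ-mod-inverse i) (flipBy-involutive p b)) (rim-walk (toℕ i) (flipBy p b))
      where p = parity (toℕ i)
    reach (v i , b) =
      retarget (cong (v i ,_) (not-involutive b)) (reach (u i , not b) ◅◅ lift Γ _ (inj₁ (spoke i)) ◅ ε)

  parities⇒bipartite : 2 ∣ n × 2 ∣ toℕ a × ¬ 2 ∣ toℕ r → Bipartite Γ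
  parities⇒bipartite (2∣n , 2∣a , 2∤r) = colour , λ _ _ → [ proper , (λ e → ≢-sym (proper e)) ]
    where
    colour : RWVertex n → Bool
    colour (u i) = flipBy (parity (toℕ i)) false
    colour (v i) = flipBy (parity (toℕ i)) true

    parity-1 : parity (toℕ (1 mod n)) ≡ 1ℙ
    parity-1 = trans (cong parity (toℕ-mod 1)) (parity-% 1 n 2∣n)

    shift-odd : ∀ i j b → parity (toℕ j) ≡ 1ℙ →
                flipBy (parity (toℕ (i ⊕ j))) b ≡ not (flipBy (parity (toℕ i)) b)
    shift-odd i j b odd =
      trans (cong (λ p → flipBy p b) (parity-⊕-odd 2∣n i j odd)) (flipBy-⁻¹ (parity (toℕ i)) b)

    shift-even : ∀ i j b → parity (toℕ j) ≡ 0ℙ →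
                 flipBy (parity (toℕ (i ⊕ j))) b ≡ flipBy (parity (toℕ i)) b
    shift-even i j b even = cong (λ p → flipBy p b) (parity-⊕-even 2∣n i j even)

    colour-flips : ∀ {x y} → RWEdge n a r x y → colour y ≡ not (colour x)
    colour-flips (rim i)    = shift-odd i (1 mod n) false parity-1
    colour-flips (hub i)    = shift-odd i r true (¬2∣⇒parity≡1ℙ (toℕ r) 2∤r)
    colour-flips (spoke i)  = flipBy-not (parity (toℕ i)) false
    colour-flips (spoke' i) =
      trans (flipBy-not (parity (toℕ i)) false) (cong not (sym (shift-even i a false (2∣⇒parity≡0ℙ 2∣a))))

    proper : ∀ {x y} → RWEdge n a r x y → colour x ≢ colour y
    proper e eq = not-¬ refl (trans eq (colour-flips e))

  ¬liftsJoined⇒parities : ¬ LiftsJoined → 2 ∣ n × 2 ∣ toℕ a × ¬ 2 ∣ toℕ r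
  ¬liftsJoined⇒parities ¬joined with 2 ∣? n | 2 ∣? toℕ a | 2 ∣? toℕ r
  ... | no 2∤n  | _       | _       = contradiction (2∤n⇒liftsJoined 2∤n) ¬joined
  ... | yes _   | no 2∤a  | _       = contradiction (2∤a⇒liftsJoined 2∤a) ¬joined
  ... | yes _   | yes _   | yes 2∣r = contradiction (2∣r⇒liftsJoined 2∣r) ¬joined
  ... | yes 2∣n | yes 2∣a | no 2∤r  = 2∣n , 2∣a , 2∤r

  disconnected⇒parities : Disconnected (DoubleCover Γ) → 2 ∣ n × 2 ∣ toℕ a × ¬ 2 ∣ toℕ r
  disconnected⇒parities disconnected = ¬liftsJoined⇒parities (disconnected ∘ liftsJoined⇒connected)

lemma3p2 : (n : ℕ) .{{_ : NonZero n}} → 3 ≤ n → (a r : Fin n) → toℕ a ≢ 0 → toℕ r ≢ 0 →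
    (Bipartite (RoseWindow n a r) ⇔ Disconnected (DoubleCover (RoseWindow n a r)))
    × (Disconnected (DoubleCover (RoseWindow n a r)) ⇔ (2 ∣ n × 2 ∣ toℕ a × ¬ (2 ∣ toℕ r)))
lemma3p2 n _ a r _ _ =
  mk⇔ bipartite⇒disconnected (parities⇒bipartite ∘ disconnected⇒parities) ,
  mk⇔ disconnected⇒parities (bipartite⇒disconnected ∘ parities⇒bipartite)
  where open RoseWindowDoubleCover n a r
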